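{- Let $G$ be an $n$-vertex graph and $A \subseteq V(G)$. For every $X \subseteq A$ that is the union of $t$ independent sets, there exists $X' \subseteq X$ with $|X'| \le t\cdot \mathrm{umim}(A)$ and $N(X)\setminus A = N(X')\setminus A$. In particular, $|\{N(X)\setminus A : X \in \mathsf{IS}(A)\}| \le n^{\mathrm{umim}(A)}$, where $\mathsf{IS}(A)$ is the set of independent sets of $G[A]$.
   Context: For $U\subseteq V(G)$, $N(U) = \bigcup_{x\in U} N(x)\setminus U$. For $A\subseteq V(G)$, $\overline{A}=V(G)\setminus A$, $E(\overline{A})$ is the set of edges of $G$ with both endpoints in $\overline{A}$, and $\mathrm{umim}(A)$ is the maximum size of a matching $M$ in the graph $G-E(\overline{A})$ (obtained by deleting $E(\overline{A})$) such that every edge of $M$ has one endpoint in $A$ and the other in $\overline{A}$ and $M$ is induced in $G-E(\overline{A})$ (the subgraph of $G-E(\overline{A})$ induced by the endpoints of $M$ has no edges other than $M$). -}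

module Defs where

open import Data.Nat using (ℕ; zero; suc)
open import Data.Bool using (Bool; true; false; _∧_; _∨_; not)
open import Data.Fin using (Fin; zero; suc)
open import Data.Fin.Subset using (Subset; _∈_; _∉_)
open import Data.Vec using (tabulate; lookup)
open import Data.Product using (_×_; Σ; ∃; proj₁; proj₂)
open import Relation.Binary.PropositionalEquality using (_≡_; _≢_)
open import Relation.Nullary using (¬_)

record Graph (n : ℕ) : Set where
  field
    adj   : Fin n → Fin n → Bool
    sym   : ∀ u v → adj u v ≡ adj v u
    irrefl : ∀ v → adj v v ≡ false
open Graph public

anyFin : ∀ {m} → (Fin m → Bool) → Bool
anyFin {zero}  f = false
anyFin {suc m} f = f zero ∨ anyFin (λ i → f (suc i))

N : ∀ {n} → Graph n → Subset n → Subset n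
N G U = tabulate λ v → not (lookup U v) ∧ anyFin (λ u → lookup U u ∧ adj G u v)

Independent : ∀ {n} → Graph n → Subset n → Set
Independent G X = ∀ u v → u ∈ X → v ∈ X → adj G u v ≡ false

UnionOfIndep : ∀ {n} → Graph n → ℕ → Subset n → Set
UnionOfIndep {n} G t X =
  Σ (Fin t → Subset n) λ I →
    (∀ i → Independent G (I i)) ×
    (∀ v → (v ∈ X → ∃ λ i → v ∈ I i) × (∀ i → v ∈ I i → v ∈ X))

-- A matching of size k in G - E(Ā) with every edge between A and Ā,
-- which is induced in G - E(Ā).
-- Edges of G - E(Ā) are exactly the edges of G with at least one endpoint in A.
-- The edges are pairwise distinct and vertex-disjoint (a matching), and for
-- i ≠ j there is no edge of G - E(Ā) between an endpoint of edge i and an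
-- endpoint of edge j: i.e. a_i a_j and a_i b_j are non-edges of G
-- (b_i b_j lies in E(Ā) and is deleted, so it is allowed).
IsUMIM : ∀ {n} → Graph n → Subset n → (k : ℕ) → (Fin k → Fin n × Fin n) → Set
IsUMIM G A k M =
  (∀ i → proj₁ (M i) ∈ A) ×
  (∀ i → proj₂ (M i) ∉ A) ×
  (∀ i → adj G (proj₁ (M i)) (proj₂ (M i)) ≡ true) ×
  (∀ i j → i ≢ j →
     (proj₁ (M i) ≢ proj₁ (M j)) ×
     (proj₂ (M i) ≢ proj₂ (M j)) ×
     (adj G (proj₁ (M i)) (proj₁ (M j)) ≡ false) ×
     (adj G (proj₁ (M i)) (proj₂ (M j)) ≡ false))

open import Data.Nat using (_≤_)
IsUmimValue : ∀ {n} → Graph n → Subset n → ℕ → Set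
IsUmimValue {n} G A k =
  (Σ (Fin k → Fin n × Fin n) λ M → IsUMIM G A k M) ×
  (∀ m (M : Fin m → Fin n × Fin n) → IsUMIM G A m M → m ≤ k)

module Submission where

-- If a vertex y of an independent X ⊆ A has no private neighbour outside A
-- (a vertex of Ā adjacent to y and to no other vertex of X), deleting y leaves N(X) \ A
-- unchanged. Once every vertex y of X has such a neighbour b_y, the edges y b_y form an
-- induced matching of G − E(Ā) between A and Ā, so |X| ≤ umim(A). Pruning each of the t
-- independent sets gives X'. For the count, N(X) \ A is determined by the pruned set of
-- size ≤ k; listing it and padding with vertices outside A encodes it as a word of length
-- k over the n vertices, from which it is read back as the letters lying in A.

open import Defs hiding (sym)
open import Data.Nat using (ℕ; _≤_; _*_; _^_)
open import Data.Fin.Subset using (Subset; _⊆_; _─_; ∣_∣)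
open import Data.List using (List; length)
open import Data.List.Relation.Unary.All using (All)
open import Data.List.Relation.Unary.Unique.Propositional using (Unique)
open import Data.Product using (_×_; Σ; ∃)
open import Relation.Binary.PropositionalEquality using (_≡_)

open import Data.Bool using (Bool; true; false; not; _∧_)
open import Data.Bool.Properties using (∧-conicalˡ; ∧-conicalʳ; ¬-not) renaming (_≟_ to _≟ᵇ_)
open import Data.Fin using (Fin; zero; suc; toℕ; fromℕ<; inject≤; funToFin; finToFun)
open import Data.Fin.Properties as Finₚ using (any?; all?; injective⇒≤; finToFun-funToFin)
open import Data.Fin.Subset using (_∈_; _∉_; _∪_; _-_; _⊂_; ⁅_⁆; inside; outside) renaming (⊥ to ∅)
open import Data.Fin.Subset.Induction using (⊂-wellFounded)
open import Data.Fin.Subset.Properties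
  using (_∈?_; ⊆-antisym; x∈p∪q⁻; p⊆p∪q; q⊆p∪q; ∉⊥; ∣⊥∣≡0;
         x∈p∧x∉q⇒x∈p─q; x∈p∧x≢y⇒x∈p-y; p─q⊆p; x∈p⇒p-x⊂p)
open import Data.List using (lookup)
import Data.List.Relation.Unary.All as All
open import Data.List.Relation.Unary.AllPairs using (_∷_)
open import Data.List.Membership.Propositional.Properties using (∈-lookup)
import Data.Nat as ℕ
import Data.Nat.Properties as ℕₚ
open import Data.Product using (_,_; proj₁; proj₂)
open import Data.Sum using (_⊎_; inj₁; inj₂)
open import Data.Vec using ([]; _∷_; here; there) renaming (lookup to lookupᵛ)
open import Data.Vec.Properties using (lookup∘tabulate; []=⇒lookup; lookup⇒[]=)
open import Function using (_∘_; id)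
open import Induction.WellFounded using (Acc; acc)
open import Relation.Binary.PropositionalEquality
  using (_≢_; refl; sym; trans; cong; cong₂; subst; _≗_; module ≡-Reasoning)
open import Relation.Nullary using (¬_; Dec; yes; no; contradiction)
open import Relation.Nullary.Decidable using (_×-dec_; _→-dec_; ¬?; decidable-stable)

private
  variable
    n k m t : ℕ

x∈p─q⇒x∉q : ∀ {x : Fin n} (p q : Subset n) → x ∈ p ─ q → x ∉ q
x∈p─q⇒x∉q (_ ∷ p) (inside ∷ q) ()  here
x∈p─q⇒x∉q (_ ∷ p) (_ ∷ q) (there x∈) (there x∈q) = x∈p─q⇒x∉q p q x∈ x∈q

x∉p⇒lookup≡outside : ∀ {x : Fin n} (p : Subset n) → x ∉ p → lookupᵛ p x ≡ outside
x∉p⇒lookup≡outside {x = x} p x∉p with lookupᵛ p x in eq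
... | true  = contradiction (lookup⇒[]= x p eq) x∉p
... | false = refl

∣p∪q∣≤∣p∣+∣q∣ : (p q : Subset n) → ∣ p ∪ q ∣ ≤ ∣ p ∣ ℕ.+ ∣ q ∣
∣p∪q∣≤∣p∣+∣q∣ []            []            = ℕ.z≤n
∣p∪q∣≤∣p∣+∣q∣ (inside ∷ p)  (inside ∷ q)  =
  ℕ.s≤s (ℕₚ.≤-trans (∣p∪q∣≤∣p∣+∣q∣ p q) (ℕₚ.+-monoʳ-≤ ∣ p ∣ (ℕₚ.n≤1+n ∣ q ∣)))
∣p∪q∣≤∣p∣+∣q∣ (inside ∷ p)  (outside ∷ q) = ℕ.s≤s (∣p∪q∣≤∣p∣+∣q∣ p q)
∣p∪q∣≤∣p∣+∣q∣ (outside ∷ p) (inside ∷ q)  =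
  subst (ℕ.suc ∣ p ∪ q ∣ ≤_) (sym (ℕₚ.+-suc ∣ p ∣ ∣ q ∣)) (ℕ.s≤s (∣p∪q∣≤∣p∣+∣q∣ p q))
∣p∪q∣≤∣p∣+∣q∣ (outside ∷ p) (outside ∷ q) = ∣p∪q∣≤∣p∣+∣q∣ p q

elements : (p : Subset n) → Fin ∣ p ∣ → Fin n
elements (inside ∷ p)  zero    = zero
elements (inside ∷ p)  (suc i) = suc (elements p i)
elements (outside ∷ p) i       = suc (elements p i)

elements-∈ : (p : Subset n) (i : Fin ∣ p ∣) → elements p i ∈ p
elements-∈ (inside ∷ p)  zero    = here
elements-∈ (inside ∷ p)  (suc i) = there (elements-∈ p i)
elements-∈ (outside ∷ p) i       = there (elements-∈ p i)

elements-injective : (p : Subset n) {i j : Fin ∣ p ∣} → elements p i ≡ elements p j → i ≡ j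
elements-injective (inside ∷ p)  {zero}  {zero}  _  = refl
elements-injective (inside ∷ p)  {suc i} {suc j} eq = cong suc (elements-injective p (Finₚ.suc-injective eq))
elements-injective (outside ∷ p)                 eq = elements-injective p (Finₚ.suc-injective eq)

elements-surjective : (p : Subset n) {x : Fin n} → x ∈ p → ∃ λ i → elements p i ≡ x
elements-surjective (inside ∷ p)  here        = zero , refl
elements-surjective (inside ∷ p)  (there x∈p) with i , refl ← elements-surjective p x∈p = suc i , refl
elements-surjective (outside ∷ p) (there x∈p) with i , refl ← elements-surjective p x∈p = i , refl

⋃ᶠ : (Fin t → Subset n) → Subset n
⋃ᶠ {t = ℕ.zero}  f = ∅
⋃ᶠ {t = ℕ.suc t} f = f zero ∪ ⋃ᶠ (f ∘ suc)

x∈⋃ᶠ⁺ : (f : Fin t → Subset n) (i : Fin t) {x : Fin n} → x ∈ f i → x ∈ ⋃ᶠ f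
x∈⋃ᶠ⁺ f zero    x∈ = p⊆p∪q (⋃ᶠ (f ∘ suc)) x∈
x∈⋃ᶠ⁺ f (suc i) x∈ = q⊆p∪q (f zero) (⋃ᶠ (f ∘ suc)) (x∈⋃ᶠ⁺ (f ∘ suc) i x∈)

⋃ᶠ-least : (f : Fin t → Subset n) {p : Subset n} → (∀ i → f i ⊆ p) → ⋃ᶠ f ⊆ p
⋃ᶠ-least {t = ℕ.zero}  f f⊆p x∈ = contradiction x∈ ∉⊥
⋃ᶠ-least {t = ℕ.suc t} f f⊆p x∈ with x∈p∪q⁻ (f zero) (⋃ᶠ (f ∘ suc)) x∈
... | inj₁ x∈f₀ = f⊆p zero x∈f₀
... | inj₂ x∈⋃  = ⋃ᶠ-least (f ∘ suc) (f⊆p ∘ suc) x∈⋃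

∣⋃ᶠ∣≤ : (f : Fin t → Subset n) → (∀ i → ∣ f i ∣ ≤ k) → ∣ ⋃ᶠ f ∣ ≤ t * k
∣⋃ᶠ∣≤ {t = ℕ.zero} {n = n} f _ = ℕₚ.≤-reflexive (∣⊥∣≡0 n)
∣⋃ᶠ∣≤ {t = ℕ.suc t} f ∣f∣≤k = ℕₚ.≤-trans (∣p∪q∣≤∣p∣+∣q∣ (f zero) (⋃ᶠ (f ∘ suc)))
  (ℕₚ.+-mono-≤ (∣f∣≤k zero) (∣⋃ᶠ∣≤ (f ∘ suc) (∣f∣≤k ∘ suc)))

anyFin⁺ : (f : Fin m → Bool) (i : Fin m) → f i ≡ true → anyFin f ≡ true
anyFin⁺ f zero    fi rewrite fi = refl
anyFin⁺ f (suc i) fi with f zero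
... | true  = refl
... | false = anyFin⁺ (f ∘ suc) i fi

anyFin⁻ : (f : Fin m → Bool) → anyFin f ≡ true → ∃ λ i → f i ≡ true
anyFin⁻ {m = ℕ.suc m} f h with f zero in f₀
... | true  = zero , f₀
... | false with i , fi ← anyFin⁻ (f ∘ suc) h = suc i , fi

module _ {a} {A : Set a} where

  Unique⇒lookup-injective : {xs : List A} → Unique xs → ∀ i j → lookup xs i ≡ lookup xs j → i ≡ j
  Unique⇒lookup-injective (_   ∷ _) zero    zero    _  = refl
  Unique⇒lookup-injective (x∉ ∷ _) zero    (suc j) eq = contradiction eq (All.lookup x∉ (∈-lookup j))
  Unique⇒lookup-injective (x∉ ∷ _) (suc i) zero    eq = contradiction (sym eq) (All.lookup x∉ (∈-lookup i))
  Unique⇒lookup-injective (_   ∷ u) (suc i) (suc j) eq = cong suc (Unique⇒lookup-injective u i j eq)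

  length≤-if-encodable : ∀ {p} {P : A → Set p} (code : ∀ {x} → P x → Fin m) →
    (∀ {x y} (px : P x) (py : P y) → code px ≡ code py → x ≡ y) →
    {xs : List A} → Unique xs → All P xs → length xs ≤ m
  length≤-if-encodable {m = m} code code-injective {xs} u pxs =
    injective⇒≤ {f = codeAt} λ {i} {j} eq → Unique⇒lookup-injective u i j (code-injective _ _ eq)
    where
    codeAt : Fin (length xs) → Fin m
    codeAt i = code (All.lookup pxs (∈-lookup i))

module Padded (pad : Fin k → Fin n) where

  encode : Subset n → Fin k → Fin n
  encode p j with toℕ j ℕ.<? ∣ p ∣
  ... | yes j<∣p∣ = elements p (fromℕ< j<∣p∣)
  ... | no  _     = pad j

  encode-∈⊎pad : (p : Subset n) (j : Fin k) → encode p j ∈ p ⊎ encode p j ≡ pad j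
  encode-∈⊎pad p j with toℕ j ℕ.<? ∣ p ∣
  ... | yes j<∣p∣ = inj₁ (elements-∈ p (fromℕ< j<∣p∣))
  ... | no  _     = inj₂ refl

  encode-inject≤ : (p : Subset n) (i : Fin ∣ p ∣) (∣p∣≤k : ∣ p ∣ ≤ k) →
                   encode p (inject≤ i ∣p∣≤k) ≡ elements p i
  encode-inject≤ p i ∣p∣≤k with toℕ (inject≤ i ∣p∣≤k) ℕ.<? ∣ p ∣
  ... | yes lt = cong (elements p) (Finₚ.toℕ-injective
                   (trans (Finₚ.toℕ-fromℕ< lt) (Finₚ.toℕ-inject≤ i ∣p∣≤k)))
  ... | no ¬lt = contradiction (subst (ℕ._< ∣ p ∣) (sym (Finₚ.toℕ-inject≤ i ∣p∣≤k)) (Finₚ.toℕ<n i)) ¬lt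

  encode-hits : (p : Subset n) → ∣ p ∣ ≤ k → {x : Fin n} → x ∈ p → ∃ λ j → encode p j ≡ x
  encode-hits p ∣p∣≤k x∈p with i , refl ← elements-surjective p x∈p =
    inject≤ i ∣p∣≤k , encode-inject≤ p i ∣p∣≤k

  encode-⊆ : {A p q : Subset n} → (∀ j → pad j ∉ A) → p ⊆ A → ∣ p ∣ ≤ k →
             encode p ≗ encode q → p ⊆ q
  encode-⊆ {A = A} {p} {q} pad∉A p⊆A ∣p∣≤k eq x∈p
    with j , refl ← encode-hits p ∣p∣≤k x∈p | encode-∈⊎pad q j
  ... | inj₁ ∈q   = subst (_∈ q) (sym (eq j)) ∈q
  ... | inj₂ ≡pad = contradiction (subst (_∈ A) (trans (eq j) ≡pad) (p⊆A x∈p)) (pad∉A j)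

  encode-injective : {A p q : Subset n} → (∀ j → pad j ∉ A) → p ⊆ A → q ⊆ A →
                     ∣ p ∣ ≤ k → ∣ q ∣ ≤ k → encode p ≗ encode q → p ≡ q
  encode-injective pad∉A p⊆A q⊆A ∣p∣≤k ∣q∣≤k eq =
    ⊆-antisym (encode-⊆ pad∉A p⊆A ∣p∣≤k eq) (encode-⊆ pad∉A q⊆A ∣q∣≤k (sym ∘ eq))

module _ (G : Graph n) (A : Subset n) where

  Dominates : Subset n → Fin n → Set
  Dominates U v = ∃ λ u → u ∈ U × adj G u v ≡ true

  _≼_ : Subset n → Subset n → Set
  U ≼ U′ = ∀ v → v ∉ A → Dominates U v → Dominates U′ v

  ≼-trans : {U V W : Subset n} → U ≼ V → V ≼ W → U ≼ W
  ≼-trans U≼V V≼W v v∉A = V≼W v v∉A ∘ U≼V v v∉A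

  ∈N⁺ : {U : Subset n} {v : Fin n} → v ∉ U → Dominates U v → v ∈ N G U
  ∈N⁺ {U} {v} v∉U (u , u∈U , uv) = lookup⇒[]= v (N G U) (begin
    lookupᵛ (N G U) v
      ≡⟨ lookup∘tabulate _ v ⟩
    not (lookupᵛ U v) ∧ anyFin (λ w → lookupᵛ U w ∧ adj G w v)
      ≡⟨ cong₂ _∧_ (cong not (x∉p⇒lookup≡outside U v∉U)) (anyFin⁺ _ u (cong₂ _∧_ ([]=⇒lookup u∈U) uv)) ⟩
    true
      ∎)
    where open ≡-Reasoning

  ∈N⁻ : {U : Subset n} {v : Fin n} → v ∈ N G U → Dominates U v
  ∈N⁻ {U} {v} v∈N
    with u , uv ← anyFin⁻ _ (∧-conicalʳ _ _ (trans (sym (lookup∘tabulate _ v)) ([]=⇒lookup v∈N))) =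
    u , lookup⇒[]= u U (∧-conicalˡ _ _ uv) , ∧-conicalʳ _ _ uv

  N─A-mono : {U U′ : Subset n} → U′ ⊆ A → U ≼ U′ → N G U ─ A ⊆ N G U′ ─ A
  N─A-mono {U} U′⊆A U≼U′ v∈ =
    x∈p∧x∉q⇒x∈p─q (∈N⁺ (v∉A ∘ U′⊆A) (U≼U′ _ v∉A (∈N⁻ (p─q⊆p (N G U) A v∈)))) v∉A
    where v∉A = x∈p─q⇒x∉q (N G U) A v∈

  N─A-≡ : {U U′ : Subset n} → U ⊆ A → U′ ⊆ U → U ≼ U′ → N G U ─ A ≡ N G U′ ─ A
  N─A-≡ U⊆A U′⊆U U≼U′ = ⊆-antisym (N─A-mono (U⊆A ∘ U′⊆U) U≼U′)
    (N─A-mono U⊆A λ { v _ (u , u∈U′ , uv) → u , U′⊆U u∈U′ , uv })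

  PrivateNeighbour : Subset n → Fin n → Fin n → Set
  PrivateNeighbour Y y b = b ∉ A × adj G y b ≡ true × (∀ y′ → y′ ∈ Y → y′ ≢ y → adj G y′ b ≡ false)

  HasPrivateNeighbour : Subset n → Fin n → Set
  HasPrivateNeighbour Y y = ∃ (PrivateNeighbour Y y)

  Irredundant : Subset n → Set
  Irredundant Y = ∀ y → y ∈ Y → HasPrivateNeighbour Y y

  hasPrivateNeighbour? : (Y : Subset n) (y : Fin n) → Dec (HasPrivateNeighbour Y y)
  hasPrivateNeighbour? Y y = any? λ b → ¬? (b ∈? A) ×-dec (adj G y b ≟ᵇ true) ×-dec
    all? (λ y′ → y′ ∈? Y →-dec ¬? (y′ Finₚ.≟ y) →-dec (adj G y′ b ≟ᵇ false))

  ¬hasPrivateNeighbour⇒redundant : {Y : Subset n} {y : Fin n} → ¬ HasPrivateNeighbour Y y → Y ≼ (Y - y)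
  ¬hasPrivateNeighbour⇒redundant {Y} {y} noPrivate v v∉A (u , u∈Y , uv) with u Finₚ.≟ y
  ... | no u≢y = u , x∈p∧x≢y⇒x∈p-y u∈Y u≢y , uv
  ... | yes refl with any? (λ y′ → y′ ∈? Y ×-dec ¬? (y′ Finₚ.≟ u) ×-dec (adj G y′ v ≟ᵇ true))
  ...   | yes (y′ , y′∈Y , y′≢u , y′v) = y′ , x∈p∧x≢y⇒x∈p-y y′∈Y y′≢u , y′v
  ...   | no  noOther = contradiction (v , v∉A , uv , private′) noPrivate
    where
    private′ : ∀ y′ → y′ ∈ Y → y′ ≢ u → adj G y′ v ≡ false
    private′ y′ y′∈Y y′≢u = ¬-not λ y′v → noOther (y′ , y′∈Y , y′≢u , y′v)

  irredundant-subset : (Y : Subset n) → Σ (Subset n) λ Y′ → Y′ ⊆ Y × Y ≼ Y′ × Irredundant Y′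
  irredundant-subset Y = prune Y (⊂-wellFounded Y)
    where
    prune : (Y : Subset n) → Acc _⊂_ Y → Σ (Subset n) λ Y′ → Y′ ⊆ Y × Y ≼ Y′ × Irredundant Y′
    prune Y (acc smaller) with any? (λ y → y ∈? Y ×-dec ¬? (hasPrivateNeighbour? Y y))
    ... | no none = Y , id , (λ _ _ → id) ,
      λ y y∈Y → decidable-stable (hasPrivateNeighbour? Y y) λ noPrivate → none (y , y∈Y , noPrivate)
    ... | yes (y , y∈Y , noPrivate)
      with Y′ , Y′⊆Y-y , Y-y≼Y′ , irr ← prune (Y - y) (smaller (x∈p⇒p-x⊂p y∈Y)) =
      Y′ , p─q⊆p Y ⁅ y ⁆ ∘ Y′⊆Y-y , ≼-trans (¬hasPrivateNeighbour⇒redundant noPrivate) Y-y≼Y′ , irr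

  privateMatching : {Y : Subset n} → Irredundant Y → Fin ∣ Y ∣ → Fin n × Fin n
  privateMatching {Y} irr i = elements Y i , proj₁ (irr (elements Y i) (elements-∈ Y i))

  privateMatching-isUMIM : {Y : Subset n} → Y ⊆ A → Independent G Y → (irr : Irredundant Y) →
                           IsUMIM G A ∣ Y ∣ (privateMatching irr)
  privateMatching-isUMIM {Y} Y⊆A indY irr =
    (λ i → Y⊆A (a∈Y i)) , (λ i → proj₁ (private-b i)) , ab ,
    λ i j i≢j → i≢j ∘ elements-injective Y , bᵢ≢bⱼ i j i≢j ,
                indY (a i) (a j) (a∈Y i) (a∈Y j) , excl i j i≢j
    where
    a b : Fin ∣ Y ∣ → Fin n
    a = proj₁ ∘ privateMatching irr
    b = proj₂ ∘ privateMatching irr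
    a∈Y : ∀ i → a i ∈ Y
    a∈Y = elements-∈ Y
    private-b : ∀ i → PrivateNeighbour Y (a i) (b i)
    private-b i = proj₂ (irr (a i) (a∈Y i))
    ab : ∀ i → adj G (a i) (b i) ≡ true
    ab i = proj₁ (proj₂ (private-b i))
    excl : ∀ i j → i ≢ j → adj G (a i) (b j) ≡ false
    excl i j i≢j = proj₂ (proj₂ (private-b j)) (a i) (a∈Y i) (i≢j ∘ elements-injective Y)
    bᵢ≢bⱼ : ∀ i j → i ≢ j → b i ≢ b j
    bᵢ≢bⱼ i j i≢j bᵢ≡bⱼ = contradiction (begin
      true              ≡⟨ sym (ab j) ⟩
      adj G (a j) (b j) ≡⟨ cong (adj G (a j)) (sym bᵢ≡bⱼ) ⟩
      adj G (a j) (b i) ≡⟨ excl j i (i≢j ∘ sym) ⟩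
      false             ∎) λ ()
      where open ≡-Reasoning

  record Core (k : ℕ) (X : Subset n) : Set where
    field
      core      : Subset n
      core⊆     : core ⊆ X
      ∣core∣≤   : ∣ core ∣ ≤ k
      ≼core     : X ≼ core

  open Core

  module _ {k : ℕ} (umim : IsUmimValue G A k) where

    independent-core : {X : Subset n} → X ⊆ A → Independent G X → Core k X
    independent-core {X} X⊆A indX with X′ , X′⊆X , X≼X′ , irr ← irredundant-subset X = record
      { core    = X′
      ; core⊆   = X′⊆X
      ; ∣core∣≤ = proj₂ umim ∣ X′ ∣ (privateMatching irr) (privateMatching-isUMIM (X⊆A ∘ X′⊆X) indX′ irr)
      ; ≼core   = X≼X′
      }
      where
      indX′ : Independent G X′
      indX′ u v u∈X′ v∈X′ = indX u v (X′⊆X u∈X′) (X′⊆X v∈X′)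

    unionOfIndep-core : {t : ℕ} {X : Subset n} → X ⊆ A → UnionOfIndep G t X → Core (t * k) X
    unionOfIndep-core {t} {X} X⊆A (I , indI , cover) = record
      { core    = ⋃ᶠ (core ∘ C)
      ; core⊆   = ⋃ᶠ-least (core ∘ C) λ i → I⊆X i ∘ core⊆ (C i)
      ; ∣core∣≤ = ∣⋃ᶠ∣≤ (core ∘ C) (∣core∣≤ ∘ C)
      ; ≼core   = X≼⋃
      }
      where
      I⊆X : ∀ i → I i ⊆ X
      I⊆X i {v} = proj₂ (cover v) i
      C : (i : Fin t) → Core k (I i)
      C i = independent-core (X⊆A ∘ I⊆X i) (indI i)
      X≼⋃ : X ≼ ⋃ᶠ (core ∘ C)
      X≼⋃ v v∉A (u , u∈X , uv) with i , u∈I ← proj₁ (cover u) u∈X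
        with w , w∈C , wv ← ≼core (C i) v v∉A (u , u∈I , uv) = w , x∈⋃ᶠ⁺ (core ∘ C) i w∈C , wv

    IndependentNeighbourhood : Subset n → Set
    IndependentNeighbourhood S = Σ (Subset n) λ X → X ⊆ A × Independent G X × S ≡ N G X ─ A

    -- the Ā-endpoints of a maximum matching pad the codes of sets with fewer than k elements
    pad : Fin k → Fin n
    pad = proj₂ ∘ proj₁ (proj₁ umim)

    pad∉A : ∀ j → pad j ∉ A
    pad∉A = proj₁ (proj₂ (proj₂ (proj₁ umim)))

    open Padded pad

    neighbourhoodCode : {S : Subset n} → IndependentNeighbourhood S → Fin (n ^ k)
    neighbourhoodCode (X , X⊆A , indX , _) = funToFin (encode (core (independent-core X⊆A indX)))

    neighbourhoodCode-injective : {S S′ : Subset n}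
      (p : IndependentNeighbourhood S) (p′ : IndependentNeighbourhood S′) →
      neighbourhoodCode p ≡ neighbourhoodCode p′ → S ≡ S′
    neighbourhoodCode-injective {S} {S′} p@(X , X⊆A , indX , S≡) p′@(X′ , X′⊆A , indX′ , S′≡) eq = begin
      S                 ≡⟨ S≡ ⟩
      N G X ─ A         ≡⟨ N─A-≡ X⊆A (core⊆ C) (≼core C) ⟩
      N G (core C) ─ A  ≡⟨ cong (λ Y → N G Y ─ A) same-core ⟩
      N G (core C′) ─ A ≡⟨ N─A-≡ X′⊆A (core⊆ C′) (≼core C′) ⟨
      N G X′ ─ A        ≡⟨ S′≡ ⟨
      S′                ∎
      where
      open ≡-Reasoning
      C : Core k X
      C = independent-core X⊆A indX
      C′ : Core k X′
      C′ = independent-core X′⊆A indX′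
      same-encoding : encode (core C) ≗ encode (core C′)
      same-encoding j = begin
        encode (core C) j                ≡⟨ finToFun-funToFin (encode (core C)) j ⟨
        finToFun (neighbourhoodCode p) j  ≡⟨ cong (λ c → finToFun c j) eq ⟩
        finToFun (neighbourhoodCode p′) j ≡⟨ finToFun-funToFin (encode (core C′)) j ⟩
        encode (core C′) j               ∎
      same-core : core C ≡ core C′
      same-core = encode-injective pad∉A (X⊆A ∘ core⊆ C) (X′⊆A ∘ core⊆ C′) (∣core∣≤ C) (∣core∣≤ C′) same-encoding

open Core

lemma2 : ∀ {n} (G : Graph n) (A : Subset n) (k : ℕ) → IsUmimValue G A k →
    (∀ (t : ℕ) (X : Subset n) → X ⊆ A → UnionOfIndep G t X →
       Σ (Subset n) λ X' → X' ⊆ X × ∣ X' ∣ ≤ t * k × (N G X ─ A ≡ N G X' ─ A))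
    ×
    (∀ (L : List (Subset n)) → Unique L →
       All (λ S → Σ (Subset n) λ X → X ⊆ A × Independent G X × S ≡ N G X ─ A) L →
       length L ≤ n ^ k)
lemma2 G A k umim =
  smallCore , λ _ → length≤-if-encodable (neighbourhoodCode G A umim) (neighbourhoodCode-injective G A umim)
  where
  smallCore : ∀ t X → X ⊆ A → UnionOfIndep G t X →
              Σ (Subset _) λ X' → X' ⊆ X × ∣ X' ∣ ≤ t * k × (N G X ─ A ≡ N G X' ─ A)
  smallCore t X X⊆A union = core C , core⊆ C , ∣core∣≤ C , N─A-≡ G A X⊆A (core⊆ C) (≼core C)
    where
    C : Core G A (t * k) X
    C = unionOfIndep-core G A umim X⊆A union
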